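{- Let $G$ be a reduced graph and let $H$ be an induced subgraph of $G$ of maximum possible order subject to the condition that $H$ has duplicated vertices. Suppose $\mathrm{rank}(H)\geqslant \mathrm{rank}(G)-3$. Then: (i) if $c$ is an isolated vertex of $H$, then $N_G(c)=V(G)\setminus V(H)$; (ii) every duplication class of $H$ has exactly two elements, and $H$ has at most one isolated vertex; (iii) if $\{v_1,v_1'\},\ldots,\{v_s,v_s'\}$ are all the duplication classes of $H$, then, after suitably labeling the two elements of each class, there exist two disjoint sets $T_1,T_2$ with $V(G)\setminus V(H)=T_1\cup T_2$, $T_1\subseteq N_G(v_i)\setminus N_G(v_i')$ and $T_2\subseteq N_G(v_i')\setminus N_G(v_i)$ for all $i\in\{1,\ldots,s\}$; (iv) if sets $T_1,T_2$ as in (iii) are both non-empty, then $H$ has no isolated vertex.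
   Context: All graphs are finite and simple. The rank of a graph is the rank over $\mathbb{R}$ of its adjacency matrix. A graph is reduced if it has no isolated vertices and no two distinct vertices with the same set of neighbors. Two distinct vertices of a graph are duplicated vertices if they have the same set of neighbors in that graph. A duplication class of a graph is a maximal set $S$ of vertices with $|S|>1$ such that all vertices in $S$ have the same neighborhood in that graph. $N_G(v)$ denotes the set of neighbors of $v$ in $G$. -}

module Defs where

open import Data.Nat using (ℕ; zero; suc; _≤_; _<_)
open import Data.Bool using (Bool; true; false; if_then_else_)
open import Data.Fin using (Fin; zero; suc)
open import Data.Fin.Subset using (Subset; _∈_; _∉_; _⊆_; ∣_∣)
open import Data.Rational using (ℚ; 0ℚ; 1ℚ; _+_; _*_)
open import Data.Product using (Σ; ∃; ∃-syntax; _×_; _,_)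
open import Data.Sum using (_⊎_)
open import Relation.Binary.PropositionalEquality using (_≡_; _≢_)
open import Relation.Nullary using (¬_)
open import Function.Definitions using (Injective)

record Graph (n : ℕ) : Set where
  field
    adj    : Fin n → Fin n → Bool
    sym    : ∀ u v → adj u v ≡ adj v u
    irrefl : ∀ v → adj v v ≡ false
open Graph public

module _ {n : ℕ} (G : Graph n) where

  Nb : Fin n → Fin n → Set
  Nb u v = adj G u v ≡ true

  Reduced : Set
  Reduced = (∀ v → ∃[ w ] Nb v w)
          × (∀ u v → u ≢ v → ¬ (∀ w → adj G u w ≡ adj G v w))

  -- The induced subgraph H = G[S] is represented by its vertex set S.
  -- Same neighbourhood in H = G[S]:
  SameNbh : Subset n → Fin n → Fin n → Set
  SameNbh S u v = ∀ w → w ∈ S → adj G u w ≡ adj G v w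

  HasDup : Subset n → Set
  HasDup S = ∃[ u ] ∃[ v ] (u ∈ S × v ∈ S × u ≢ v × SameNbh S u v)

  MaxDup : Subset n → Set
  MaxDup S = HasDup S × (∀ S' → HasDup S' → ∣ S' ∣ ≤ ∣ S ∣)

  IsolatedIn : Subset n → Fin n → Set
  IsolatedIn S c = c ∈ S × (∀ w → w ∈ S → adj G c w ≡ false)

  DupSet : Subset n → Subset n → Set
  DupSet S C = C ⊆ S × 1 < ∣ C ∣ × (∀ u v → u ∈ C → v ∈ C → SameNbh S u v)

  DupClass : Subset n → Subset n → Set
  DupClass S C = DupSet S C × (∀ C' → C ⊆ C' → DupSet S C' → C' ⊆ C)

  Σℚ : ∀ {k} → (Fin k → ℚ) → ℚ
  Σℚ {zero}  f = 0ℚ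
  Σℚ {suc k} f = f zero + Σℚ (λ i → f (suc i))

  A : Fin n → Fin n → ℚ
  A u v = if adj G u v then 1ℚ else 0ℚ

  IndepRows : Subset n → (k : ℕ) → (Fin k → Fin n) → Set
  IndepRows S k f =
    Injective _≡_ _≡_ f × (∀ i → f i ∈ S) ×
    (∀ (c : Fin k → ℚ) →
       (∀ w → w ∈ S → Σℚ (λ i → c i * A (f i) w) ≡ 0ℚ) → ∀ i → c i ≡ 0ℚ)

  RankIs : Subset n → ℕ → Set
  RankIs S r = (∃[ f ] IndepRows S r f)
             × (∀ k (f : Fin k → Fin n) → IndepRows S k f → k ≤ r)

  SplitCond : Subset n → Subset n → Subset n → Set
  SplitCond S T₁ T₂ =
    (∀ w → ¬ (w ∈ T₁ × w ∈ T₂)) ×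
    (∀ w → w ∉ S → w ∈ T₁ ⊎ w ∈ T₂) ×
    (∀ w → w ∈ T₁ ⊎ w ∈ T₂ → w ∉ S) ×
    (∀ C → DupClass S C →
       ∃[ v ] ∃[ v' ] (v ∈ C × v' ∈ C × v ≢ v' ×
         (∀ w → w ∈ T₁ → Nb v w × ¬ Nb v' w) ×
         (∀ w → w ∈ T₂ → Nb v' w × ¬ Nb v w)))

-- Everything rests on one rank count.  Suppose a combination z of rows of H = G[S] vanishes
-- on S ∪ {x} for some x ∉ S.  Bordering the adjacency matrix of H first by x, using the
-- difference of the rows of a duplicated pair of H (it vanishes on S and, by maximality of H,
-- not at x), and then by a vertex y with z y ≠ 0, using z, would give rank G ≥ rank H + 4.
-- Hence under rank G ≤ rank H + 3 such a z vanishes identically.  For the row of an isolated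
-- vertex this is (i); for combinations of the row differences of two duplicated pairs it says
-- that their sign patterns outside S agree up to a global sign, which is the labelling of
-- (iii); for A v − A v' − A c it is (iv).  Part (ii) needs only maximality (every vertex
-- outside S separates duplicated vertices), reducedness and (i).
module Submission where

open import Defs renaming (sym to adj-sym)
open import Level using (0ℓ)
open import Data.Nat as ℕ using (ℕ; zero; suc; _≤_; _<_; z≤n; s≤s)
open import Data.Nat.Properties using (m≤n⇒m≤1+n; ≤-trans; <⇒≱; +-suc; +-monoʳ-≤)
open import Data.Fin using (Fin; zero; suc; punchIn)
open import Data.Fin.Properties using (any?; all?; punchIn-punchOut)
open import Data.Fin.Subset using (Subset; _∈_; _∉_; ∣_∣; ⊥; ⊤; ⁅_⁆; inside; outside) renaming (_∪_ to _∪ˢ_)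
open import Data.Fin.Subset.Properties
  using ( _∈?_; p⊆q⇒∣p∣≤∣q∣; p⊂q⇒∣p∣<∣q∣; ∣p∣≤∣x∷p∣; ∣⊥∣≡0; ∣⁅x⁆∣≡1; x∈p∪q⁺; x∈⁅x⁆
        ; x∉⁅y⁆⇒x≢y; x≢y⇒x∉⁅y⁆; x∈⁅y⁆⇒x≡y)
open import Data.Vec as Vec using (tabulate)
open import Data.Vec.Properties using (lookup∘tabulate; []=⇒lookup; lookup⇒[]=)
open import Data.Product using (∃-syntax; _×_; _,_; proj₁; proj₂)
open import Data.Sum using (_⊎_; inj₁; inj₂)
open import Data.Empty using (⊥-elim)
open import Data.List as List using (List)
open import Data.List.Relation.Unary.Any using (here; there)
open import Data.List.Membership.Propositional using () renaming (_∈_ to _∈ˡ_)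
open import Data.Vec.Functional using (Vector; []; _∷_; insertAt; tail)
open import Data.Vec.Functional.Properties using (insertAt-lookup; insertAt-punchIn)
open import Function using (_∘_)
open import Relation.Unary using (Pred; Decidable; _∪_; ｛_｝)
open import Relation.Nullary using (¬_; Dec; yes; no; ¬?)
open import Relation.Nullary.Decidable using (map′; _×-dec_; _→-dec_; does; dec-true; decidable-stable)
open import Relation.Binary.PropositionalEquality
  using (_≡_; _≢_; _≗_; refl; sym; trans; cong; cong₂; subst; subst₂; module ≡-Reasoning)

module LinearAlgebra where

  open import Relation.Unary using (_⊆_)
  open import Data.Rational using (ℚ; 0ℚ; 1ℚ; _+_; _*_; -_; _-_; 1/_; ≢-nonZero)
  open import Data.Rational.Properties using (_≟_; +-*-commutativeRing; *-inverseˡ; *-inverseʳ; *-zeroˡ; *-zeroʳ)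
  open import Data.Rational.Solver using (module +-*-Solver)
  open import Algebra.Bundles using (CommutativeRing)
  open import Algebra.Properties.Semiring.Sum (CommutativeRing.semiring +-*-commutativeRing) public
    using (sum)
  open import Algebra.Properties.Semiring.Sum (CommutativeRing.semiring +-*-commutativeRing)
    using (sum-cong-≗; sum-replicate-zero; sum-remove; ∑-distrib-+; ∑-comm; *-distribˡ-sum; *-distribʳ-sum)
  open +-*-Solver using (solve; _:+_; _:*_; _:-_; :-_; _:=_; con)
  open ≡-Reasoning

  1≢0 : 1ℚ ≢ 0ℚ
  1≢0 ()

  *-cancelʳ-≡0 : ∀ {a b} → a * b ≡ 0ℚ → b ≢ 0ℚ → a ≡ 0ℚ
  *-cancelʳ-≡0 {a} {b} ab≡0 b≢0 = begin
    a                  ≡⟨ solve 1 (λ a → a := a :* con 1ℚ) refl a ⟩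
    a * 1ℚ             ≡⟨ cong (a *_) (sym (*-inverseʳ b {{≢-nonZero b≢0}})) ⟩
    a * (b * b⁻¹)      ≡⟨ solve 3 (λ a b c → a :* (b :* c) := (a :* b) :* c) refl a b b⁻¹ ⟩
    a * b * b⁻¹        ≡⟨ cong (_* b⁻¹) ab≡0 ⟩
    0ℚ * b⁻¹           ≡⟨ *-zeroˡ b⁻¹ ⟩
    0ℚ                 ∎
    where b⁻¹ = (1/ b) {{≢-nonZero b≢0}}

  x-y≡0⇒x≡y : ∀ {x y} → x - y ≡ 0ℚ → x ≡ y
  x-y≡0⇒x≡y {x} {y} x-y≡0 = begin
    x              ≡⟨ solve 2 (λ x y → x := x :- y :+ y) refl x y ⟩
    x - y + y      ≡⟨ cong (_+ y) x-y≡0 ⟩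
    0ℚ + y         ≡⟨ solve 1 (λ y → con 0ℚ :+ y := y) refl y ⟩
    y              ∎

  solve-for : ∀ {a x y} (a≢0 : a ≢ 0ℚ) → a * x + y ≡ 0ℚ → x ≡ (- (1/ a) {{≢-nonZero a≢0}}) * y
  solve-for {a} {x} {y} a≢0 eq = begin
    x                             ≡⟨ solve 1 (λ x → x := con 1ℚ :* x) refl x ⟩
    1ℚ * x                        ≡⟨ cong (_* x) (sym (*-inverseˡ a {{≢-nonZero a≢0}})) ⟩
    a⁻¹ * a * x                   ≡⟨ solve 4 (λ i a x y → i :* a :* x := (:- i) :* y :+ i :* (a :* x :+ y)) refl a⁻¹ a x y ⟩
    (- a⁻¹) * y + a⁻¹ * (a * x + y) ≡⟨ cong (λ e → (- a⁻¹) * y + a⁻¹ * e) eq ⟩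
    (- a⁻¹) * y + a⁻¹ * 0ℚ        ≡⟨ solve 2 (λ u i → u :+ i :* con 0ℚ := u) refl ((- a⁻¹) * y) a⁻¹ ⟩
    (- a⁻¹) * y                   ∎
    where a⁻¹ = (1/ a) {{≢-nonZero a≢0}}

  sum-zero : ∀ {k} {f : Vector ℚ k} → f ≗ (λ _ → 0ℚ) → sum f ≡ 0ℚ
  sum-zero {k} f≗0 = trans (sum-cong-≗ f≗0) (sum-replicate-zero k)

  sum-distrib-sum : ∀ {m k} (φ : Vector ℚ m) (M : Fin m → Fin k → ℚ) →
    sum (λ j → φ j * sum (M j)) ≡ sum (λ i → sum (λ j → φ j * M j i))
  sum-distrib-sum φ M = trans (sum-cong-≗ (λ j → *-distribˡ-sum (φ j) (M j))) (∑-comm (λ j i → φ j * M j i))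

  lincomb : ∀ {n k} → Vector ℚ k → Vector (Vector ℚ n) k → Vector ℚ n
  lincomb c h t = sum (λ i → c i * h i t)

  lincomb-zeroˡ : ∀ {n k} (h : Vector (Vector ℚ n) k) t → lincomb (λ _ → 0ℚ) h t ≡ 0ℚ
  lincomb-zeroˡ h t = sum-zero (λ i → *-zeroˡ (h i t))

  lincomb-linear : ∀ {n k} (a b : ℚ) (c d : Vector ℚ k) (h : Vector (Vector ℚ n) k) t →
    lincomb (λ i → a * c i + b * d i) h t ≡ a * lincomb c h t + b * lincomb d h t
  lincomb-linear a b c d h t = begin
    sum (λ i → (a * c i + b * d i) * h i t)
      ≡⟨ sum-cong-≗ (λ i → solve 5 (λ a b c d x → (a :* c :+ b :* d) :* x := a :* (c :* x) :+ b :* (d :* x))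
                              refl a b (c i) (d i) (h i t)) ⟩
    sum (λ i → a * (c i * h i t) + b * (d i * h i t))
      ≡⟨ ∑-distrib-+ (λ i → a * (c i * h i t)) (λ i → b * (d i * h i t)) ⟩
    sum (λ i → a * (c i * h i t)) + sum (λ i → b * (d i * h i t))
      ≡⟨ sym (cong₂ _+_ (*-distribˡ-sum a (λ i → c i * h i t)) (*-distribˡ-sum b (λ i → d i * h i t))) ⟩
    a * lincomb c h t + b * lincomb d h t ∎

  lincomb-scale : ∀ {n k} (a : ℚ) (c : Vector ℚ k) (h : Vector (Vector ℚ n) k) t →
    lincomb (λ i → a * c i) h t ≡ a * lincomb c h t
  lincomb-scale a c h t = begin
    sum (λ i → a * c i * h i t)
      ≡⟨ sum-cong-≗ (λ i → solve 3 (λ a c x → a :* c :* x := a :* (c :* x)) refl a (c i) (h i t)) ⟩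
    sum (λ i → a * (c i * h i t)) ≡⟨ sym (*-distribˡ-sum a (λ i → c i * h i t)) ⟩
    a * lincomb c h t             ∎

  lincomb-shift : ∀ {n k} (d s : Vector ℚ k) (h : Vector (Vector ℚ n) k) (p : Vector ℚ n) t →
    lincomb d (λ i u → h i u - s i * p u) t ≡ lincomb d h t - sum (λ i → d i * s i) * p t
  lincomb-shift d s h p t = begin
    sum (λ i → d i * (h i t - s i * p t))
      ≡⟨ sum-cong-≗ (λ i → solve 4 (λ d x s p → d :* (x :- s :* p) := d :* x :+ (:- p) :* (d :* s))
                              refl (d i) (h i t) (s i) (p t)) ⟩
    sum (λ i → d i * h i t + (- p t) * (d i * s i))
      ≡⟨ ∑-distrib-+ (λ i → d i * h i t) (λ i → (- p t) * (d i * s i)) ⟩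
    lincomb d h t + sum (λ i → (- p t) * (d i * s i))
      ≡⟨ cong (lincomb d h t +_) (sym (*-distribˡ-sum (- p t) (λ i → d i * s i))) ⟩
    lincomb d h t + (- p t) * sum (λ i → d i * s i)
      ≡⟨ solve 3 (λ x p σ → x :+ (:- p) :* σ := x :- σ :* p) refl (lincomb d h t) (p t) (sum (λ i → d i * s i)) ⟩
    lincomb d h t - sum (λ i → d i * s i) * p t ∎

  unit : ∀ {k} → Fin (suc k) → Vector ℚ (suc k)
  unit i = insertAt (λ _ → 0ℚ) i 1ℚ

  unit-diag : ∀ {k} (i : Fin (suc k)) → unit i i ≡ 1ℚ
  unit-diag i = insertAt-lookup _ i 1ℚ

  unit-offDiag : ∀ {k} {i j : Fin (suc k)} → i ≢ j → unit i j ≡ 0ℚ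
  unit-offDiag {i = i} i≢j = trans (cong (unit i) (sym (punchIn-punchOut i≢j))) (insertAt-punchIn _ i 1ℚ _)

  lincomb-unit : ∀ {n k} (i : Fin (suc k)) (h : Vector (Vector ℚ n) (suc k)) t → lincomb (unit i) h t ≡ h i t
  lincomb-unit i h t = begin
    lincomb (unit i) h t
      ≡⟨ sum-remove {i = i} (λ j → unit i j * h j t) ⟩
    unit i i * h i t + sum (λ j → unit i (punchIn i j) * h (punchIn i j) t)
      ≡⟨ cong₂ (λ a b → a * h i t + b) (unit-diag i)
               (sum-zero (λ j → trans (cong (_* h (punchIn i j) t) (insertAt-punchIn _ i 1ℚ j)) (*-zeroˡ (h (punchIn i j) t)))) ⟩
    1ℚ * h i t + 0ℚ
      ≡⟨ solve 1 (λ x → con 1ℚ :* x :+ con 0ℚ := x) refl (h i t) ⟩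
    h i t ∎

  module _ {n : ℕ} (P : Pred (Fin n) 0ℓ) where

    VanishesOn : Vector ℚ n → Set
    VanishesOn x = ∀ t → P t → x t ≡ 0ℚ

    LinIndepOn : ∀ {k} → Vector (Vector ℚ n) k → Set
    LinIndepOn h = ∀ c → VanishesOn (lincomb c h) → ∀ i → c i ≡ 0ℚ

    InSpanOn : ∀ {k} → Vector (Vector ℚ n) k → Vector ℚ n → Set
    InSpanOn h x = ∃[ d ] (∀ t → P t → x t ≡ lincomb d h t)

  module _ {n : ℕ} {P : Pred (Fin n) 0ℓ} where

    LinIndepOn-mono : ∀ {Q k} {h : Vector (Vector ℚ n) k} → P ⊆ Q → LinIndepOn P h → LinIndepOn Q h
    LinIndepOn-mono P⊆Q ind c z = ind c (λ t t∈P → z t (P⊆Q t∈P))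

    LinIndepOn⇒¬VanishesOn : ∀ {k} {h : Vector (Vector ℚ n) (suc k)} → LinIndepOn P h → ∀ i → ¬ VanishesOn P (h i)
    LinIndepOn⇒¬VanishesOn {h = h} ind i hᵢ≈0 =
      1≢0 (trans (sym (unit-diag i)) (ind (unit i) (λ t t∈P → trans (lincomb-unit i h t) (hᵢ≈0 t t∈P)) i))

    LinIndepOn⇒distinct : ∀ {k} {h : Vector (Vector ℚ n) (suc k)} → LinIndepOn P h →
      ∀ {i j} → i ≢ j → ¬ (∀ t → P t → h i t ≡ h j t)
    LinIndepOn⇒distinct {h = h} ind {i} {j} i≢j hᵢ≈hⱼ = 1≢0 (begin
      1ℚ                             ≡⟨ refl ⟩
      1ℚ * 1ℚ + (- 1ℚ) * 0ℚ          ≡⟨ sym (cong₂ (λ a b → 1ℚ * a + (- 1ℚ) * b) (unit-diag i) (unit-offDiag (i≢j ∘ sym))) ⟩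
      c i                            ≡⟨ ind c c-vanishes i ⟩
      0ℚ                             ∎)
      where
        c = λ l → 1ℚ * unit i l + (- 1ℚ) * unit j l
        c-vanishes : VanishesOn P (lincomb c h)
        c-vanishes t t∈P = begin
          lincomb c h t                                   ≡⟨ lincomb-linear 1ℚ (- 1ℚ) (unit i) (unit j) h t ⟩
          1ℚ * lincomb (unit i) h t + (- 1ℚ) * lincomb (unit j) h t
            ≡⟨ cong₂ (λ a b → 1ℚ * a + (- 1ℚ) * b) (lincomb-unit i h t) (lincomb-unit j h t) ⟩
          1ℚ * h i t + (- 1ℚ) * h j t                     ≡⟨ cong (λ a → 1ℚ * a + (- 1ℚ) * h j t) (hᵢ≈hⱼ t t∈P) ⟩
          1ℚ * h j t + (- 1ℚ) * h j t
            ≡⟨ solve 1 (λ x → con 1ℚ :* x :+ (:- con 1ℚ) :* x := con 0ℚ) refl (h j t) ⟩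
          0ℚ                                              ∎

    LinIndepOn-∷ : ∀ {k} {h : Vector (Vector ℚ n) k} {x} → LinIndepOn P h → ¬ InSpanOn P h x → LinIndepOn P (x ∷ h)
    LinIndepOn-∷ {h = h} {x} ind x∉span c z = λ { zero → c₀≡0 ; (suc i) → ind (tail c) tail-vanishes i }
      where
        c₀≡0 : c zero ≡ 0ℚ
        c₀≡0 with c zero ≟ 0ℚ
        ... | yes c₀≡0 = c₀≡0
        ... | no c₀≢0 = ⊥-elim (x∉span ((λ i → μ * c (suc i)) , λ t t∈P →
                trans (solve-for c₀≢0 (z t t∈P)) (sym (lincomb-scale μ (tail c) h t))))
          where μ = - (1/ c zero) {{≢-nonZero c₀≢0}}
        tail-vanishes : VanishesOn P (lincomb (tail c) h)
        tail-vanishes t t∈P = begin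
          lincomb (tail c) h t                 ≡⟨ solve 2 (λ x l → l := con 0ℚ :* x :+ l) refl (x t) (lincomb (tail c) h t) ⟩
          0ℚ * x t + lincomb (tail c) h t      ≡⟨ cong (λ a → a * x t + lincomb (tail c) h t) (sym c₀≡0) ⟩
          c zero * x t + lincomb (tail c) h t  ≡⟨ z t t∈P ⟩
          0ℚ                                   ∎

    InSpanOn-∷ : ∀ {k} {h : Vector (Vector ℚ n) k} {x y} → InSpanOn P h x → InSpanOn P (y ∷ h) x
    InSpanOn-∷ {h = h} {x} {y} (d , x≡) = (0ℚ ∷ d) , λ t t∈P →
      trans (x≡ t t∈P) (solve 2 (λ y l → l := con 0ℚ :* y :+ l) refl (y t) (lincomb d h t))

    InSpanOn-∷⁻ : ∀ {k} {h : Vector (Vector ℚ n) k} {x y} (d : Vector ℚ (suc k)) →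
      (∀ t → P t → d zero * y t ≡ 0ℚ) → (∀ t → P t → x t ≡ lincomb d (y ∷ h) t) → InSpanOn P h x
    InSpanOn-∷⁻ {h = h} {x} {y} d head≈0 x≡ = tail d , λ t t∈P → begin
      x t                                     ≡⟨ x≡ t t∈P ⟩
      d zero * y t + lincomb (tail d) h t     ≡⟨ cong (_+ lincomb (tail d) h t) (head≈0 t t∈P) ⟩
      0ℚ + lincomb (tail d) h t               ≡⟨ solve 1 (λ l → con 0ℚ :+ l := l) refl (lincomb (tail d) h t) ⟩
      lincomb (tail d) h t                    ∎

    module Pivot (p : Vector ℚ n) (w₀ : Fin n) (p₀≢0 : p w₀ ≢ 0ℚ) where

      ratio : Vector ℚ n → ℚ
      ratio y = y w₀ * (1/ p w₀) {{≢-nonZero p₀≢0}}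

      sweep : Vector ℚ n → Vector ℚ n
      sweep y u = y u - ratio y * p u

      ratio-pivot : ratio p ≡ 1ℚ
      ratio-pivot = *-inverseʳ (p w₀) {{≢-nonZero p₀≢0}}

      ratio-lincomb : ∀ {k} (d : Vector ℚ k) (h : Vector (Vector ℚ n) k) →
        ratio (lincomb d h) ≡ sum (λ i → d i * ratio (h i))
      ratio-lincomb d h = trans (*-distribʳ-sum _ (λ i → d i * h i w₀))
        (sum-cong-≗ (λ i → solve 3 (λ d x r → d :* x :* r := d :* (x :* r)) refl (d i) (h i w₀) _))

      sweep-spans : ∀ {k} {h : Vector (Vector ℚ n) k} {x} → P w₀ →
        InSpanOn P (p ∷ h) x → InSpanOn P (sweep ∘ h) (sweep x)
      sweep-spans {h = h} {x} w₀∈P (d , x≡) = tail d , λ t t∈P → begin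
        x t - ratio x * p t
          ≡⟨ cong₂ (λ a b → a - b * (1/ p w₀) {{≢-nonZero p₀≢0}} * p t) (x≡ t t∈P) (x≡ w₀ w₀∈P) ⟩
        lincomb d (p ∷ h) t - ratio (lincomb d (p ∷ h)) * p t
          ≡⟨ cong (λ a → lincomb d (p ∷ h) t - a * p t) (ratio-lincomb d (p ∷ h)) ⟩
        d zero * p t + L t - (d zero * ratio p + Σ) * p t
          ≡⟨ cong (λ a → d zero * p t + L t - (d zero * a + Σ) * p t) ratio-pivot ⟩
        d zero * p t + L t - (d zero * 1ℚ + Σ) * p t
          ≡⟨ solve 4 (λ d p l s → d :* p :+ l :- (d :* con 1ℚ :+ s) :* p := l :- s :* p) refl (d zero) (p t) (L t) Σ ⟩
        L t - Σ * p t
          ≡⟨ sym (lincomb-shift (tail d) (ratio ∘ h) h p t) ⟩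
        lincomb (tail d) (sweep ∘ h) t ∎
        where
          L = lincomb (tail d) h
          Σ = sum (λ i → tail d i * ratio (h i))

      unsweep-spans : ∀ {k} {h : Vector (Vector ℚ n) k} {x} →
        InSpanOn P (sweep ∘ h) (sweep x) → InSpanOn P (p ∷ h) x
      unsweep-spans {h = h} {x} (d , sx≡) = (ratio x - Σ ∷ d) , λ t t∈P → begin
        x t                                    ≡⟨ solve 3 (λ x r p → x := x :- r :* p :+ r :* p) refl (x t) (ratio x) (p t) ⟩
        sweep x t + ratio x * p t
          ≡⟨ cong (_+ ratio x * p t) (trans (sx≡ t t∈P) (lincomb-shift d (ratio ∘ h) h p t)) ⟩
        lincomb d h t - Σ * p t + ratio x * p t
          ≡⟨ solve 4 (λ l s p r → l :- s :* p :+ r :* p := (r :- s) :* p :+ l) refl (lincomb d h t) Σ (p t) (ratio x) ⟩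
        (ratio x - Σ) * p t + lincomb d h t    ∎
        where Σ = sum (λ i → d i * ratio (h i))

    InSpanOn? : Decidable P → ∀ {k} (h : Vector (Vector ℚ n) k) x → Dec (InSpanOn P h x)
    InSpanOn? P? {zero} h x = map′ (λ x≈0 → (λ ()) , x≈0) proj₂ (all? (λ t → P? t →-dec (x t ≟ 0ℚ)))
    InSpanOn? P? {suc k} h x with any? (λ w → P? w ×-dec ¬? (h zero w ≟ 0ℚ))
    ... | yes (w₀ , w₀∈P , p₀≢0) =
      map′ unsweep-spans (sweep-spans w₀∈P) (InSpanOn? P? (sweep ∘ tail h) (sweep x))
      where open Pivot (h zero) w₀ p₀≢0
    ... | no no-pivot =
      map′ InSpanOn-∷ (λ (d , x≡) → InSpanOn-∷⁻ d (λ t t∈P → trans (cong (d zero *_) (h₀≈0 t t∈P)) (*-zeroʳ (d zero))) x≡)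
        (InSpanOn? P? (tail h) x)
      where
        h₀≈0 : VanishesOn P (h zero)
        h₀≈0 t t∈P = decidable-stable (h zero t ≟ 0ℚ) (λ h₀≢0 → no-pivot (t , t∈P , h₀≢0))

    InSpanOn-eliminate : ∀ {k} {x y : Vector ℚ n} {g : Vector (Vector ℚ n) (suc k)} (d e : Vector ℚ (suc k)) μ →
      (∀ t → P t → x t ≡ lincomb d g t) → (∀ t → P t → y t ≡ lincomb e g t) → d zero ≡ μ * e zero →
      InSpanOn P (tail g) (λ u → x u - μ * y u)
    InSpanOn-eliminate {x = x} {y} {g} d e μ x≡ y≡ d₀≡μe₀ = InSpanOn-∷⁻ c c₀g≈0 λ t t∈P → begin
      x t - μ * y t                             ≡⟨ cong₂ (λ a b → a - μ * b) (x≡ t t∈P) (y≡ t t∈P) ⟩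
      lincomb d g t - μ * lincomb e g t
        ≡⟨ solve 3 (λ a m b → a :- m :* b := con 1ℚ :* a :+ (:- m) :* b) refl (lincomb d g t) μ (lincomb e g t) ⟩
      1ℚ * lincomb d g t + (- μ) * lincomb e g t ≡⟨ sym (lincomb-linear 1ℚ (- μ) d e g t) ⟩
      lincomb c g t                             ∎
      where
        c = λ i → 1ℚ * d i + (- μ) * e i
        c₀g≈0 : ∀ t → P t → c zero * g zero t ≡ 0ℚ
        c₀g≈0 t _ = begin
          (1ℚ * d zero + (- μ) * e zero) * g zero t    ≡⟨ cong (λ a → (1ℚ * a + (- μ) * e zero) * g zero t) d₀≡μe₀ ⟩
          (1ℚ * (μ * e zero) + (- μ) * e zero) * g zero t
            ≡⟨ solve 3 (λ m a b → (con 1ℚ :* (m :* a) :+ (:- m) :* a) :* b := con 0ℚ) refl μ (e zero) (g zero t) ⟩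
          0ℚ                                              ∎

    LinIndepOn-shear : ∀ {k} {h : Vector (Vector ℚ n) (suc k)} (j₀ : Fin (suc k)) (μ : Vector ℚ k) →
      LinIndepOn P h → LinIndepOn P (λ j u → h (punchIn j₀ j) u - μ j * h j₀ u)
    LinIndepOn-shear {h = h} j₀ μ ind c z j =
      trans (sym (insertAt-punchIn c j₀ (- Σ) j)) (ind C C-vanishes (punchIn j₀ j))
      where
        Σ = sum (λ j → c j * μ j)
        C = insertAt c j₀ (- Σ)
        hᵣ = h ∘ punchIn j₀
        C-vanishes : VanishesOn P (lincomb C h)
        C-vanishes t t∈P = begin
          lincomb C h t
            ≡⟨ sum-remove {i = j₀} (λ i → C i * h i t) ⟩
          C j₀ * h j₀ t + sum (λ j → C (punchIn j₀ j) * hᵣ j t)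
            ≡⟨ cong₂ (λ a b → a * h j₀ t + b) (insertAt-lookup c j₀ (- Σ))
                     (sum-cong-≗ (λ j → cong (_* hᵣ j t) (insertAt-punchIn c j₀ (- Σ) j))) ⟩
          (- Σ) * h j₀ t + lincomb c hᵣ t
            ≡⟨ solve 3 (λ s x l → (:- s) :* x :+ l := l :- s :* x) refl Σ (h j₀ t) (lincomb c hᵣ t) ⟩
          lincomb c hᵣ t - Σ * h j₀ t
            ≡⟨ sym (lincomb-shift c μ hᵣ (h j₀) t) ⟩
          lincomb c (λ j u → hᵣ j u - μ j * h j₀ u) t
            ≡⟨ z t t∈P ⟩
          0ℚ ∎

    -- Induction on r: either no member of h involves g₀, or g₀ is eliminated from all members but one.
    steinitz : ∀ {p r} (h : Vector (Vector ℚ n) p) (g : Vector (Vector ℚ n) r) →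
      LinIndepOn P h → (∀ j → InSpanOn P g (h j)) → p ≤ r
    steinitz {zero} h g ind h∈span = z≤n
    steinitz {suc p} {zero} h g ind h∈span = ⊥-elim (LinIndepOn⇒¬VanishesOn {h = h} ind zero (proj₂ (h∈span zero)))
    steinitz {suc p} {suc r} h g ind h∈span with any? (λ j → ¬? (proj₁ (h∈span j) zero ≟ 0ℚ))
    ... | no ∄j = m≤n⇒m≤1+n (steinitz h (tail g) ind λ j →
          InSpanOn-∷⁻ (coeff j) (λ t _ → trans (cong (_* g zero t) (coeff₀≡0 j)) (*-zeroˡ (g zero t))) (proj₂ (h∈span j)))
      where
        coeff = λ j → proj₁ (h∈span j)
        coeff₀≡0 : ∀ j → coeff j zero ≡ 0ℚ
        coeff₀≡0 j = decidable-stable (coeff j zero ≟ 0ℚ) (λ c≢0 → ∄j (j , c≢0))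
    ... | yes (j₀ , a≢0) = s≤s (steinitz h′ (tail g) (LinIndepOn-shear {h = h} j₀ μ ind) λ j →
          InSpanOn-eliminate {g = g} (coeff (punchIn j₀ j)) (coeff j₀) (μ j)
            (proj₂ (h∈span (punchIn j₀ j))) (proj₂ (h∈span j₀)) (head-ratio j))
      where
        coeff = λ j → proj₁ (h∈span j)
        a = coeff j₀ zero
        a⁻¹ = (1/ a) {{≢-nonZero a≢0}}
        μ : Vector ℚ p
        μ j = coeff (punchIn j₀ j) zero * a⁻¹
        h′ : Vector (Vector ℚ n) p
        h′ j u = h (punchIn j₀ j) u - μ j * h j₀ u
        head-ratio : ∀ j → coeff (punchIn j₀ j) zero ≡ μ j * a
        head-ratio j = let c = coeff (punchIn j₀ j) zero in begin
          c                 ≡⟨ solve 1 (λ c → c := c :* con 1ℚ) refl c ⟩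
          c * 1ℚ            ≡⟨ cong (c *_) (sym (*-inverseˡ a {{≢-nonZero a≢0}})) ⟩
          c * (a⁻¹ * a)     ≡⟨ solve 3 (λ c i a → c :* (i :* a) := c :* i :* a) refl c a⁻¹ a ⟩
          c * a⁻¹ * a       ∎

  module _ {n : ℕ} (P : Pred (Fin n) 0ℓ) (R : Fin n → Vector ℚ n) where

    record RowBasis (L : List (Fin n)) : Set where
      field
        size        : ℕ
        vertex      : Vector (Fin n) size
        vertex∈     : ∀ i → P (vertex i)
        independent : LinIndepOn P (R ∘ vertex)
        spans       : ∀ {v} → v ∈ˡ L → P v → InSpanOn P (R ∘ vertex) (R v)

    private
      spanning-∷ : ∀ {v L} (B : RowBasis L) → (P v → InSpanOn P (R ∘ RowBasis.vertex B) (R v)) → RowBasis (v List.∷ L)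
      spanning-∷ B v∈span = record
        { size = size ; vertex = vertex ; vertex∈ = vertex∈ ; independent = independent
        ; spans = λ { (here refl) → v∈span ; (there u∈L) → spans u∈L } }
        where open RowBasis B

    rowBasis : Decidable P → ∀ L → RowBasis L
    rowBasis P? List.[] = record { size = 0 ; vertex = [] ; vertex∈ = λ () ; independent = λ _ _ () ; spans = λ () }
    rowBasis P? (v List.∷ L) with rowBasis P? L | P? v
    ... | B | no v∉P = spanning-∷ B (λ v∈P → ⊥-elim (v∉P v∈P))
    ... | B | yes v∈P with InSpanOn? P? (R ∘ RowBasis.vertex B) (R v)
    ...   | yes v∈span = spanning-∷ B (λ _ → v∈span)
    ...   | no v∉span = record
      { size        = suc size
      ; vertex      = v ∷ vertex
      ; vertex∈     = λ { zero → v∈P ; (suc i) → vertex∈ i }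
      ; independent = LinIndepOn-∷ independent v∉span
      ; spans       = λ { (here refl) _ → unit zero , λ t _ → sym (lincomb-unit zero (R ∘ (v ∷ vertex)) t)
                        ; (there u∈L) u∈P → InSpanOn-∷ (spans u∈L u∈P) }
      }
      where open RowBasis B

  module _ {n : ℕ} (R : Fin n → Vector ℚ n) where

    record RowComb (P : Pred (Fin n) 0ℓ) (x : Vector ℚ n) : Set where
      field
        {terms} : ℕ
        coeff   : Vector ℚ terms
        vertex  : Vector (Fin n) terms
        vertex∈ : ∀ j → P (vertex j)
        expand  : ∀ t → x t ≡ lincomb coeff (R ∘ vertex) t

    rowComb : ∀ {P m} (φ : Vector ℚ m) (w : Vector (Fin n) m) → (∀ j → P (w j)) → RowComb P (lincomb φ (R ∘ w))
    rowComb φ w w∈P = record { coeff = φ ; vertex = w ; vertex∈ = w∈P ; expand = λ _ → refl }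

    RowComb-row : ∀ {P v} → P v → RowComb P (R v)
    RowComb-row {v = v} v∈P = record
      { coeff = unit zero ; vertex = v ∷ [] ; vertex∈ = λ { zero → v∈P }
      ; expand = λ t → sym (lincomb-unit zero (R ∘ (v ∷ [])) t) }

    RowComb-mono : ∀ {P Q x} → P ⊆ Q → RowComb P x → RowComb Q x
    RowComb-mono P⊆Q X = record { RowComb X ; vertex∈ = λ j → P⊆Q (RowComb.vertex∈ X j) }

    RowComb⇒InSpanOn : ∀ {P k x} {g : Vector (Vector ℚ n) k} →
      (∀ v → P v → InSpanOn P g (R v)) → RowComb P x → InSpanOn P g x
    RowComb⇒InSpanOn {P} {x = x} {g} rows∈span X = d , λ t t∈P → begin
      x t                                                   ≡⟨ expand t ⟩
      sum (λ j → coeff j * R (vertex j) t)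
        ≡⟨ sum-cong-≗ (λ j → cong (coeff j *_) (proj₂ (rows∈span _ (vertex∈ j)) t t∈P)) ⟩
      sum (λ j → coeff j * sum (λ i → D j i * g i t))        ≡⟨ sum-distrib-sum coeff (λ j i → D j i * g i t) ⟩
      sum (λ i → sum (λ j → coeff j * (D j i * g i t)))     ≡⟨ sum-cong-≗ (λ i → regroup i t) ⟩
      lincomb d g t                                         ∎
      where
        open RowComb X
        D = λ j → proj₁ (rows∈span (vertex j) (vertex∈ j))
        d = λ i → sum (λ j → coeff j * D j i)
        regroup : ∀ i t → sum (λ j → coeff j * (D j i * g i t)) ≡ d i * g i t
        regroup i t = trans (sum-cong-≗ (λ j → solve 3 (λ c d x → c :* (d :* x) := c :* d :* x) refl (coeff j) (D j i) (g i t)))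
                            (sym (*-distribʳ-sum (g i t) (λ j → coeff j * D j i)))

    -- For symmetric R this is the bilinear form of R with one argument given as a row combination.
    ⟪_∣_⟫ : ∀ {P x} → RowComb P x → Vector ℚ n → ℚ
    ⟪ X ∣ y ⟫ = sum (λ j → coeff j * y (vertex j)) where open RowComb X

    ⟪∣⟫-lincomb : ∀ {P x k} (X : RowComb P x) (c : Vector ℚ k) (F : Vector (Vector ℚ n) k) →
      ⟪ X ∣ lincomb c F ⟫ ≡ sum (λ i → c i * ⟪ X ∣ F i ⟫)
    ⟪∣⟫-lincomb X c F = begin
      sum (λ j → coeff j * sum (λ i → c i * F i (vertex j)))      ≡⟨ sum-distrib-sum coeff (λ j i → c i * F i (vertex j)) ⟩
      sum (λ i → sum (λ j → coeff j * (c i * F i (vertex j))))    ≡⟨ sum-cong-≗ (λ i → regroup i) ⟩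
      sum (λ i → c i * ⟪ X ∣ F i ⟫)                               ∎
      where
        open RowComb X
        regroup : ∀ i → sum (λ j → coeff j * (c i * F i (vertex j))) ≡ c i * ⟪ X ∣ F i ⟫
        regroup i = trans
          (sum-cong-≗ (λ j → solve 3 (λ a c f → a :* (c :* f) := c :* (a :* f)) refl (coeff j) (c i) (F i (vertex j))))
                          (sym (*-distribˡ-sum (c i) (λ j → coeff j * F i (vertex j))))

    ⟪∣⟫-vanishes : ∀ {P x y} (X : RowComb P x) → VanishesOn P y → ⟪ X ∣ y ⟫ ≡ 0ℚ
    ⟪∣⟫-vanishes X y≈0 = sum-zero (λ j → trans (cong (coeff j *_) (y≈0 _ (vertex∈ j))) (*-zeroʳ (coeff j)))
      where open RowComb X

    module _ (R-sym : ∀ u v → R u v ≡ R v u) where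

      ⟪∣⟫-sym : ∀ {P Q x y} (X : RowComb P x) (Y : RowComb Q y) → ⟪ X ∣ y ⟫ ≡ ⟪ Y ∣ x ⟫
      ⟪∣⟫-sym {x = x} {y} X Y = begin
        sum (λ j → φ j * y (w j))                             ≡⟨ sum-cong-≗ (λ j → cong (φ j *_) (Y.expand (w j))) ⟩
        sum (λ j → φ j * sum (λ l → ψ l * R (v l) (w j)))     ≡⟨ sum-distrib-sum φ (λ j l → ψ l * R (v l) (w j)) ⟩
        sum (λ l → sum (λ j → φ j * (ψ l * R (v l) (w j))))   ≡⟨ sum-cong-≗ (λ l → sum-cong-≗ (λ j → swap l j)) ⟩
        sum (λ l → sum (λ j → ψ l * (φ j * R (w j) (v l))))
          ≡⟨ sum-cong-≗ (λ l → sym (*-distribˡ-sum (ψ l) (λ j → φ j * R (w j) (v l)))) ⟩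
        sum (λ l → ψ l * sum (λ j → φ j * R (w j) (v l)))     ≡⟨ sum-cong-≗ (λ l → cong (ψ l *_) (sym (X.expand (v l)))) ⟩
        sum (λ l → ψ l * x (v l))                             ∎
        where
          module X = RowComb X
          module Y = RowComb Y
          φ = X.coeff ; w = X.vertex ; ψ = Y.coeff ; v = Y.vertex
          swap : ∀ l j → φ j * (ψ l * R (v l) (w j)) ≡ ψ l * (φ j * R (w j) (v l))
          swap l j = trans (cong (λ r → φ j * (ψ l * r)) (R-sym (v l) (w j)))
                           (solve 3 (λ a b r → a :* (b :* r) := b :* (a :* r)) refl (φ j) (ψ l) (R (w j) (v l)))

      ⟪∣⟫-bordered : ∀ {P k b x} {h : Vector (Vector ℚ n) k} (X : RowComb P x) → VanishesOn P x →
        (∀ i → RowComb P (h i)) → ∀ c → ⟪ X ∣ lincomb c (R b ∷ x ∷ h) ⟫ ≡ c zero * x b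
      ⟪∣⟫-bordered {b = b} {x} {h} X x≈0 H c = begin
        ⟪ X ∣ lincomb c (R b ∷ x ∷ h) ⟫                   ≡⟨ ⟪∣⟫-lincomb X c (R b ∷ x ∷ h) ⟩
        c zero * ⟪ X ∣ R b ⟫ + (c₁ * ⟪ X ∣ x ⟫ + sum (λ i → c₂ i * ⟪ X ∣ h i ⟫))
          ≡⟨ cong₂ (λ p q → c zero * p + (c₁ * ⟪ X ∣ x ⟫ + q)) ⟪X∣Rb⟫≡xb
                   (sum-zero (λ i → trans (cong (c₂ i *_) (⟪X∣hᵢ⟫≡0 i)) (*-zeroʳ (c₂ i)))) ⟩
        c zero * x b + (c₁ * ⟪ X ∣ x ⟫ + 0ℚ)             ≡⟨ cong (λ q → c zero * x b + (c₁ * q + 0ℚ)) (⟪∣⟫-vanishes X x≈0) ⟩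
        c zero * x b + (c₁ * 0ℚ + 0ℚ)
          ≡⟨ solve 3 (λ a y s → a :* y :+ (s :* con 0ℚ :+ con 0ℚ) := a :* y) refl (c zero) (x b) c₁ ⟩
        c zero * x b                                     ∎
        where
          c₁ = c (suc zero)
          c₂ = λ i → c (suc (suc i))
          ⟪X∣Rb⟫≡xb : ⟪ X ∣ R b ⟫ ≡ x b
          ⟪X∣Rb⟫≡xb = trans (⟪∣⟫-sym X (RowComb-row {P = ｛ b ｝} refl)) (solve 1 (λ a → con 1ℚ :* a :+ con 0ℚ := a) refl (x b))
          ⟪X∣hᵢ⟫≡0 : ∀ i → ⟪ X ∣ h i ⟫ ≡ 0ℚ
          ⟪X∣hᵢ⟫≡0 i = trans (⟪∣⟫-sym X (H i)) (⟪∣⟫-vanishes (H i) x≈0)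

      module _ {P : Pred (Fin n) 0ℓ} {k b x} {h : Vector (Vector ℚ n) k}
               (X : RowComb P x) (x≈0 : VanishesOn P x) (xb≢0 : x b ≢ 0ℚ) (H : ∀ i → RowComb P (h i)) where

        bordered-RowComb : ∀ i → RowComb (P ∪ ｛ b ｝) ((R b ∷ x ∷ h) i)
        bordered-RowComb zero          = RowComb-row (inj₂ refl)
        bordered-RowComb (suc zero)    = RowComb-mono inj₁ X
        bordered-RowComb (suc (suc i)) = RowComb-mono inj₁ (H i)

        -- Testing a vanishing combination against X kills every term but the one of R b.
        bordered-LinIndepOn : LinIndepOn P h → LinIndepOn (P ∪ ｛ b ｝) (R b ∷ x ∷ h)
        bordered-LinIndepOn ind c z = λ { zero → c₀≡0 ; (suc zero) → c₁≡0 ; (suc (suc i)) → c₂≡0 i }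
          where
            c₁ = c (suc zero)
            c₂ = λ i → c (suc (suc i))
            c₀≡0 : c zero ≡ 0ℚ
            c₀≡0 = *-cancelʳ-≡0 (trans (sym (⟪∣⟫-bordered X x≈0 H c)) (⟪∣⟫-vanishes X (λ t t∈P → z t (inj₁ t∈P)))) xb≢0
            c₂≡0 : ∀ i → c₂ i ≡ 0ℚ
            c₂≡0 = ind c₂ λ t t∈P → begin
              lincomb c₂ h t
                ≡⟨ solve 3 (λ a y l → l := con 0ℚ :* a :+ (y :* con 0ℚ :+ l)) refl (R b t) c₁ (lincomb c₂ h t) ⟩
              0ℚ * R b t + (c₁ * 0ℚ + lincomb c₂ h t)
                ≡⟨ cong₂ (λ p q → p * R b t + (c₁ * q + lincomb c₂ h t)) (sym c₀≡0) (sym (x≈0 t t∈P)) ⟩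
              lincomb c (R b ∷ x ∷ h) t    ≡⟨ z t (inj₁ t∈P) ⟩
              0ℚ                           ∎
            c₁≡0 : c₁ ≡ 0ℚ
            c₁≡0 = *-cancelʳ-≡0 (begin
              c₁ * x b
                ≡⟨ solve 3 (λ a y s → s :* y := con 0ℚ :* a :+ (s :* y :+ con 0ℚ)) refl (R b b) (x b) c₁ ⟩
              0ℚ * R b b + (c₁ * x b + 0ℚ)
                ≡⟨ cong₂ (λ p q → p * R b b + (c₁ * x b + q)) (sym c₀≡0)
                         (sym (trans (sum-cong-≗ (λ i → cong (_* h i b) (c₂≡0 i))) (lincomb-zeroˡ h b))) ⟩
              lincomb c (R b ∷ x ∷ h) b    ≡⟨ z b (inj₂ refl) ⟩
              0ℚ                           ∎) xb≢0

∣p∪q∣≤∣p∣+∣q∣ : ∀ {m} (p q : Subset m) → ∣ p ∪ˢ q ∣ ≤ ∣ p ∣ ℕ.+ ∣ q ∣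
∣p∪q∣≤∣p∣+∣q∣ Vec.[] Vec.[] = z≤n
∣p∪q∣≤∣p∣+∣q∣ (inside Vec.∷ p) (s Vec.∷ q) = s≤s (≤-trans (∣p∪q∣≤∣p∣+∣q∣ p q) (+-monoʳ-≤ ∣ p ∣ (∣p∣≤∣x∷p∣ s q)))
∣p∪q∣≤∣p∣+∣q∣ (outside Vec.∷ p) (inside Vec.∷ q) rewrite +-suc ∣ p ∣ ∣ q ∣ = s≤s (∣p∪q∣≤∣p∣+∣q∣ p q)
∣p∪q∣≤∣p∣+∣q∣ (outside Vec.∷ p) (outside Vec.∷ q) = ∣p∪q∣≤∣p∣+∣q∣ p q

module _ {n : ℕ} where

  subsetOf : {P : Pred (Fin n) 0ℓ} → Decidable P → Subset n
  subsetOf P? = tabulate (does ∘ P?)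

  module _ {P : Pred (Fin n) 0ℓ} (P? : Decidable P) where

    ∈-subsetOf⁺ : ∀ {w} → P w → w ∈ subsetOf P?
    ∈-subsetOf⁺ {w} w∈P = lookup⇒[]= w _ (trans (lookup∘tabulate (does ∘ P?) w) (dec-true (P? w) w∈P))

    ∈-subsetOf⁻ : ∀ {w} → w ∈ subsetOf P? → P w
    ∈-subsetOf⁻ {w} w∈ with P? w | trans (sym (lookup∘tabulate (does ∘ P?) w)) ([]=⇒lookup w∈)
    ... | yes w∈P | _ = w∈P
    ... | no _    | ()

  ∃-∈-∉ : (p q : Subset n) → ∣ q ∣ < ∣ p ∣ → ∃[ x ] (x ∈ p × x ∉ q)
  ∃-∈-∉ p q ∣q∣<∣p∣ with any? (λ x → (x ∈? p) ×-dec ¬? (x ∈? q))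
  ... | yes found = found
  ... | no none = ⊥-elim (<⇒≱ ∣q∣<∣p∣ (p⊆q⇒∣p∣≤∣q∣ λ {x} x∈p → decidable-stable (x ∈? q) (λ x∉q → none (x , x∈p , x∉q))))

  distinct⇒1<∣p∣ : ∀ {p : Subset n} {u v} → u ∈ p → v ∈ p → u ≢ v → 1 < ∣ p ∣
  distinct⇒1<∣p∣ {p} {u} u∈p v∈p u≢v = subst (ℕ._< ∣ p ∣) (∣⁅x⁆∣≡1 u)
    (p⊂q⇒∣p∣<∣q∣ ((λ w∈⁅u⁆ → subst (_∈ p) (sym (x∈⁅y⁆⇒x≡y u w∈⁅u⁆)) u∈p) , _ , v∈p , x≢y⇒x∉⁅y⁆ (u≢v ∘ sym)))

  two-distinct : (p : Subset n) → 1 < ∣ p ∣ → ∃[ u ] ∃[ v ] (u ∈ p × v ∈ p × u ≢ v)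
  two-distinct p 1<∣p∣ with ∃-∈-∉ p ⊥ (subst (ℕ._< ∣ p ∣) (sym (∣⊥∣≡0 n)) (≤-trans (s≤s z≤n) 1<∣p∣))
  ... | u , u∈p , _ with ∃-∈-∉ p ⁅ u ⁆ (subst (ℕ._< ∣ p ∣) (sym (∣⁅x⁆∣≡1 u)) 1<∣p∣)
  ...   | v , v∈p , v∉⁅u⁆ = u , v , u∈p , v∈p , x∉⁅y⁆⇒x≢y v∉⁅u⁆ ∘ sym

  three-distinct : (p : Subset n) → 2 < ∣ p ∣ →
    ∃[ u ] ∃[ v ] ∃[ w ] (u ∈ p × v ∈ p × w ∈ p × u ≢ v × u ≢ w × v ≢ w)
  three-distinct p 2<∣p∣ with two-distinct p (≤-trans (s≤s (s≤s z≤n)) 2<∣p∣)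
  ... | u , v , u∈p , v∈p , u≢v with ∃-∈-∉ p (⁅ u ⁆ ∪ˢ ⁅ v ⁆) (≤-trans (s≤s ∣⁅u⁆∪⁅v⁆∣≤2) 2<∣p∣)
    where
      ∣⁅u⁆∪⁅v⁆∣≤2 : ∣ ⁅ u ⁆ ∪ˢ ⁅ v ⁆ ∣ ≤ 2
      ∣⁅u⁆∪⁅v⁆∣≤2 = subst₂ (λ a b → ∣ ⁅ u ⁆ ∪ˢ ⁅ v ⁆ ∣ ≤ a ℕ.+ b) (∣⁅x⁆∣≡1 u) (∣⁅x⁆∣≡1 v) (∣p∪q∣≤∣p∣+∣q∣ ⁅ u ⁆ ⁅ v ⁆)
  ...   | w , w∈p , w∉ = u , v , w , u∈p , v∈p , w∈p , u≢v
                       , (λ { refl → w∉ (x∈p∪q⁺ (inj₁ (x∈⁅x⁆ u))) })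
                       , (λ { refl → w∉ (x∈p∪q⁺ (inj₂ (x∈⁅x⁆ v))) })

module AdjacencyRank {n : ℕ} (G : Graph n) where

  open LinearAlgebra
  open import Data.Rational using (ℚ; 0ℚ; 1ℚ; _+_; _*_)
  open import Data.Bool using (true; false; if_then_else_)
  open import Data.Fin.Subset.Properties using (∈⊤)
  open import Data.Fin using () renaming (_≟_ to _≟ᶠ_)
  open import Data.List using (allFin)
  open import Data.List.Membership.Propositional.Properties using (∈-allFin)
  open import Function.Definitions using (Injective)

  A-sym : ∀ u v → A G u v ≡ A G v u
  A-sym u v = cong (if_then 1ℚ else 0ℚ) (adj-sym G u v)

  A≡0 : ∀ {u v} → adj G u v ≡ false → A G u v ≡ 0ℚ
  A≡0 = cong (if_then 1ℚ else 0ℚ)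

  A≡1 : ∀ {u v} → adj G u v ≡ true → A G u v ≡ 1ℚ
  A≡1 = cong (if_then 1ℚ else 0ℚ)

  Σℚ≡sum : ∀ {k} (f : Vector ℚ k) → Σℚ G f ≡ sum f
  Σℚ≡sum {zero}  f = refl
  Σℚ≡sum {suc k} f = cong (f zero +_) (Σℚ≡sum (tail f))

  basis : (S : Subset n) → RowBasis (_∈ S) (A G) (allFin n)
  basis S = rowBasis (_∈ S) (A G) (_∈? S) (allFin n)

  rank : Subset n → ℕ
  rank S = RowBasis.size (basis S)

  rows-injective : ∀ {P k} (f : Vector (Fin n) k) → LinIndepOn P (A G ∘ f) → Injective _≡_ _≡_ f
  rows-injective {k = suc k} f ind {i} {j} fᵢ≡fⱼ with i ≟ᶠ j
  ... | yes i≡j = i≡j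
  ... | no i≢j = ⊥-elim (LinIndepOn⇒distinct ind i≢j (λ t _ → cong (λ v → A G v t) fᵢ≡fⱼ))

  RankIs-rank : (S : Subset n) → RankIs G S (rank S)
  RankIs-rank S =
      (vertex , rows-injective vertex independent , vertex∈
      , λ c z → independent c (λ t t∈S → trans (sym (Σℚ≡sum (λ i → c i * A G (vertex i) t))) (z t t∈S)))
                , λ k f (_ , f∈S , ind) → steinitz (A G ∘ f) (A G ∘ vertex)
                    (λ c z → ind c (λ t t∈S → trans (Σℚ≡sum (λ i → c i * A G (f i) t)) (z t t∈S)))
                    (λ j → spans (∈-allFin (f j)) (f∈S j))
    where open RowBasis (basis S)

  LinIndepOn-RowComb⇒≤rank : ∀ {P k} {F : Vector (Vector ℚ n) k} →
    (∀ i → RowComb (A G) P (F i)) → LinIndepOn P F → k ≤ rank ⊤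
  LinIndepOn-RowComb⇒≤rank F∈ ind = steinitz _ (A G ∘ vertex) (LinIndepOn-mono (λ _ → ∈⊤) ind)
    (λ i → RowComb⇒InSpanOn (A G) (λ v _ → spans (∈-allFin v) ∈⊤) (RowComb-mono (A G) (λ _ → ∈⊤) (F∈ i)))
    where open RowBasis (basis ⊤)

module MaximumDuplicated {n : ℕ} (G : Graph n) (S : Subset n) (reduced : Reduced G) (maxDup : MaxDup G S) where

  open LinearAlgebra
  open AdjacencyRank G
  open import Data.Rational using (ℚ; 0ℚ; 1ℚ; _+_; _*_; -_; _-_)
  open import Data.Rational.Properties using (_≟_)
  open import Data.Rational.Solver using (module +-*-Solver)
  open +-*-Solver using (solve; _:+_; _:*_; _:-_; :-_; _:=_; con)
  open import Data.Bool using (Bool; true; false; not; if_then_else_)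
  open import Data.Bool.Properties using (¬-not) renaming (_≟_ to _≟ᵇ_)
  open import Data.Nat.Properties using (≤-antisym; ≰⇒>; +-comm) renaming (_≤?_ to _≤ⁿ?_)
  open import Data.Fin.Subset using (_⊆_)
  open import Data.Fin using () renaming (_≟_ to _≟ᶠ_)
  open import Data.Fin.Subset.Properties using (p⊆p∪q; x∈p∪q⁻)
  open ≡-Reasoning

  record Duplicated (u u' : Fin n) : Set where
    constructor duplicated
    field
      left∈S   : u ∈ S
      right∈S  : u' ∈ S
      distinct : u ≢ u'
      sameNbh  : SameNbh G S u u'

  open Duplicated

  DupSet⇒Duplicated : ∀ {C u v} → DupSet G S C → u ∈ C → v ∈ C → u ≢ v → Duplicated u v
  DupSet⇒Duplicated (C⊆S , _ , same) u∈C v∈C u≢v = duplicated (C⊆S u∈C) (C⊆S v∈C) u≢v (same _ _ u∈C v∈C)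

  separated : ∀ {u u' x} → Duplicated u u' → x ∉ S → adj G u x ≢ adj G u' x
  separated {u} {u'} {x} (duplicated u∈S u'∈S u≢u' same) x∉S ux≡u'x =
    <⇒≱ ∣S∣<∣S+x∣ (proj₂ maxDup (S ∪ˢ ⁅ x ⁆) (u , u' , p⊆p∪q ⁅ x ⁆ u∈S , p⊆p∪q ⁅ x ⁆ u'∈S , u≢u' , same′))
    where
      ∣S∣<∣S+x∣ : ∣ S ∣ < ∣ S ∪ˢ ⁅ x ⁆ ∣
      ∣S∣<∣S+x∣ = p⊂q⇒∣p∣<∣q∣ (p⊆p∪q ⁅ x ⁆ , x , x∈p∪q⁺ (inj₂ (x∈⁅x⁆ x)) , x∉S)
      same′ : SameNbh G (S ∪ˢ ⁅ x ⁆) u u'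
      same′ w w∈ with x∈p∪q⁻ S ⁅ x ⁆ w∈
      ... | inj₁ w∈S = same w w∈S
      ... | inj₂ w∈⁅x⁆ rewrite x∈⁅y⁆⇒x≡y x w∈⁅x⁆ = ux≡u'x

  u₀ u₀' : Fin n
  u₀  = proj₁ (proj₁ maxDup)
  u₀' = proj₁ (proj₂ (proj₁ maxDup))

  dup₀ : Duplicated u₀ u₀'
  dup₀ with proj₁ maxDup
  ... | _ , _ , u∈S , u'∈S , u≢u' , same = duplicated u∈S u'∈S u≢u' same

  open Duplicated dup₀ renaming (left∈S to u₀∈S; right∈S to u₀'∈S; distinct to u₀≢u₀'; sameNbh to same₀)

  ∃-outside : ∃[ x ] x ∉ S
  ∃-outside with any? (λ w → ¬? (w ∈? S))
  ... | yes found = found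
  ... | no none = ⊥-elim (proj₂ reduced u₀ u₀' u₀≢u₀' (λ w → same₀ w (decidable-stable (w ∈? S) (λ w∉S → none (w , w∉S)))))

  x₀ = proj₁ ∃-outside
  x₀∉S = proj₂ ∃-outside

  true≢false : true ≢ false
  true≢false ()

  ≢-both : ∀ {a b c : Bool} → a ≢ b → a ≢ c → b ≡ c
  ≢-both a≢b a≢c = trans (¬-not (a≢b ∘ sym)) (sym (¬-not (a≢c ∘ sym)))

  dupClass-size : ∀ C → DupClass G S C → ∣ C ∣ ≡ 2
  dupClass-size C (dupSet@(_ , 1<∣C∣ , _) , _) with ∣ C ∣ ≤ⁿ? 2
  ... | yes ∣C∣≤2 = ≤-antisym ∣C∣≤2 1<∣C∣
  ... | no ∣C∣≰2 with three-distinct C (≰⇒> ∣C∣≰2)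
  ...   | u , v , w , u∈C , v∈C , w∈C , u≢v , u≢w , v≢w =
    ⊥-elim (separated (dup v∈C w∈C v≢w) x₀∉S (≢-both (separated (dup u∈C v∈C u≢v) x₀∉S) (separated (dup u∈C w∈C u≢w) x₀∉S)))
    where
      dup : ∀ {a b} → a ∈ C → b ∈ C → a ≢ b → Duplicated a b
      dup = DupSet⇒Duplicated dupSet

  sign : Bool → ℚ
  sign true  = 1ℚ
  sign false = - 1ℚ

  sign≢0 : ∀ a → sign a ≢ 0ℚ
  sign≢0 true  ()
  sign≢0 false ()

  sign-cancelˡ : ∀ a {b c} → sign a * sign b ≡ sign a * sign c → b ≡ c
  sign-cancelˡ true  {true}  {true}  _ = refl
  sign-cancelˡ true  {false} {false} _ = refl
  sign-cancelˡ false {true}  {true}  _ = refl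
  sign-cancelˡ false {false} {false} _ = refl
  sign-cancelˡ true  {true}  {false} ()
  sign-cancelˡ true  {false} {true}  ()
  sign-cancelˡ false {true}  {false} ()
  sign-cancelˡ false {false} {true}  ()

  Δ : Fin n → Fin n → Vector ℚ n
  Δ u u' = lincomb (1ℚ ∷ - 1ℚ ∷ []) (A G ∘ (u ∷ u' ∷ []))

  Δ-RowComb : ∀ {u u'} → Duplicated u u' → RowComb (A G) (_∈ S) (Δ u u')
  Δ-RowComb {u} {u'} (duplicated u∈S u'∈S _ _) = rowComb (A G) (1ℚ ∷ - 1ℚ ∷ []) (u ∷ u' ∷ []) λ { zero → u∈S ; (suc zero) → u'∈S }

  Δ-vanishes : ∀ {u u'} → Duplicated u u' → VanishesOn (_∈ S) (Δ u u')
  Δ-vanishes {u} {u'} (duplicated _ _ _ same) t t∈S =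
    trans (cong (λ b → 1ℚ * (if b then 1ℚ else 0ℚ) + (- 1ℚ * A G u' t + 0ℚ)) (same t t∈S))
          (solve 1 (λ a → con 1ℚ :* a :+ (:- con 1ℚ :* a :+ con 0ℚ) := con 0ℚ) refl (A G u' t))

  Δ-outside : ∀ {u u' x} → Duplicated u u' → x ∉ S → Δ u u' x ≡ sign (adj G u x)
  Δ-outside dup x∉S = Δ-sign (¬-not (separated dup x∉S ∘ sym))
    where
      Δ-sign : ∀ {a b} → b ≡ not a → 1ℚ * (if a then 1ℚ else 0ℚ) + (- 1ℚ * (if b then 1ℚ else 0ℚ) + 0ℚ) ≡ sign a
      Δ-sign {true}  refl = refl
      Δ-sign {false} refl = refl

  oriented : ∀ {C} → DupSet G S C → ∃[ v ] ∃[ v' ] (v ∈ C × v' ∈ C × Duplicated v v' × adj G v x₀ ≡ adj G u₀ x₀)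
  oriented {C} dupSet@(_ , 1<∣C∣ , _) with two-distinct C 1<∣C∣
  ... | v₁ , v₂ , v₁∈C , v₂∈C , v₁≢v₂ with adj G v₁ x₀ ≟ᵇ adj G u₀ x₀
  ...   | yes v₁-aligned = v₁ , v₂ , v₁∈C , v₂∈C , DupSet⇒Duplicated dupSet v₁∈C v₂∈C v₁≢v₂ , v₁-aligned
  ...   | no v₁-opposed = v₂ , v₁ , v₂∈C , v₁∈C , DupSet⇒Duplicated dupSet v₂∈C v₁∈C (v₁≢v₂ ∘ sym)
                        , ≢-both (separated (DupSet⇒Duplicated dupSet v₁∈C v₂∈C v₁≢v₂) x₀∉S) v₁-opposed

  on-side? : (side : Bool) → Decidable (λ w → w ∉ S × adj G u₀ w ≡ side)
  on-side? side w = ¬? (w ∈? S) ×-dec (adj G u₀ w ≟ᵇ side)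

  T₁ T₂ : Subset n
  T₁ = subsetOf (on-side? true)
  T₂ = subsetOf (on-side? false)

  twin₀? : Decidable (λ w → w ∈ S × SameNbh G S w u₀)
  twin₀? w = (w ∈? S) ×-dec all? (λ t → (t ∈? S) →-dec (adj G w t ≟ᵇ adj G u₀ t))

  class₀ : Subset n
  class₀ = subsetOf twin₀?

  class₀-DupClass : DupClass G S class₀
  class₀-DupClass = (proj₁ ∘ ∈⁻ , distinct⇒1<∣p∣ u₀∈ u₀'∈ u₀≢u₀' , same) , maximal
    where
      ∈⁻ = ∈-subsetOf⁻ twin₀?
      ∈⁺ = ∈-subsetOf⁺ twin₀?
      u₀∈ : u₀ ∈ class₀
      u₀∈ = ∈⁺ (u₀∈S , λ _ _ → refl)
      u₀'∈ : u₀' ∈ class₀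
      u₀'∈ = ∈⁺ (u₀'∈S , λ t t∈S → sym (same₀ t t∈S))
      same : ∀ u v → u ∈ class₀ → v ∈ class₀ → SameNbh G S u v
      same u v u∈ v∈ t t∈S = trans (proj₂ (∈⁻ u∈) t t∈S) (sym (proj₂ (∈⁻ v∈) t t∈S))
      maximal : ∀ C → class₀ ⊆ C → DupSet G S C → C ⊆ class₀
      maximal C class₀⊆C (C⊆S , _ , sameC) w∈C = ∈⁺ (C⊆S w∈C , sameC _ _ w∈C (class₀⊆C u₀∈))

  module RankGapAtMostThree (rank-gap : ∀ rG rH → RankIs G ⊤ rG → RankIs G S rH → rG ≤ rH ℕ.+ 3) where

    -- Otherwise bordering the rows of G[S] first by x, using Δ u₀ u₀', and then by y, using z,
    -- yields rank S + 4 independent row combinations.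
    vanishes-identically : ∀ {x z} → x ∉ S → RowComb (A G) (_∈ S) z →
      VanishesOn ((_∈ S) ∪ ｛ x ｝) z → ∀ y → z y ≡ 0ℚ
    vanishes-identically {x} {z} x∉S Z z≈0 y with z y ≟ 0ℚ
    ... | yes zy≡0 = zy≡0
    ... | no zy≢0 = ⊥-elim (<⇒≱ rank-S+3<rank-⊤ (rank-gap _ _ (RankIs-rank ⊤) (RankIs-rank S)))
      where
        open RowBasis (basis S)
        F₀∈ : ∀ i → RowComb (A G) (_∈ S) (A G (vertex i))
        F₀∈ i = RowComb-row (A G) (vertex∈ i)
        Δ₀x≢0 : Δ u₀ u₀' x ≢ 0ℚ
        Δ₀x≢0 = sign≢0 (adj G u₀ x) ∘ trans (sym (Δ-outside dup₀ x∉S))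
        F₁∈ = bordered-RowComb (A G) A-sym (Δ-RowComb dup₀) (Δ-vanishes dup₀) Δ₀x≢0 F₀∈
        F₁-indep = bordered-LinIndepOn (A G) A-sym (Δ-RowComb dup₀) (Δ-vanishes dup₀) Δ₀x≢0 F₀∈ independent
        F₂∈ = bordered-RowComb (A G) A-sym (RowComb-mono (A G) inj₁ Z) z≈0 zy≢0 F₁∈
        F₂-indep = bordered-LinIndepOn (A G) A-sym (RowComb-mono (A G) inj₁ Z) z≈0 zy≢0 F₁∈ F₁-indep
        rank-S+3<rank-⊤ : rank S ℕ.+ 3 < rank ⊤
        rank-S+3<rank-⊤ = subst (_< rank ⊤) (+-comm 3 (rank S)) (LinIndepOn-RowComb⇒≤rank F₂∈ F₂-indep)

    isolated-adjacent : ∀ {c w} → IsolatedIn G S c → w ∉ S → Nb G c w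
    isolated-adjacent {c} {w} (c∈S , isolated) w∉S with adj G c w in cw
    ... | true  = refl
    ... | false = ⊥-elim (1≢0 (trans (sym (A≡1 cy)) (vanishes-identically w∉S (RowComb-row (A G) c∈S) Ac≈0 y)))
      where
        y = proj₁ (proj₁ reduced c)
        cy = proj₂ (proj₁ reduced c)
        Ac≈0 : VanishesOn ((_∈ S) ∪ ｛ w ｝) (A G c)
        Ac≈0 t (inj₁ t∈S) = A≡0 (isolated t t∈S)
        Ac≈0 t (inj₂ refl) = A≡0 cw

    isolated-nbh : ∀ {c} → IsolatedIn G S c → ∀ w → (Nb G c w → w ∉ S) × (w ∉ S → Nb G c w)
    isolated-nbh iso@(_ , isolated) w =
      (λ cw w∈S → true≢false (trans (sym cw) (isolated w w∈S))) , isolated-adjacent iso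

    isolated-unique : ∀ {c d} → IsolatedIn G S c → IsolatedIn G S d → c ≡ d
    isolated-unique {c} {d} iso-c iso-d with c ≟ᶠ d
    ... | yes c≡d = c≡d
    ... | no c≢d = ⊥-elim (proj₂ reduced c d c≢d same)
      where
        same : ∀ w → adj G c w ≡ adj G d w
        same w with w ∈? S
        ... | yes w∈S = trans (proj₂ iso-c w w∈S) (sym (proj₂ iso-d w w∈S))
        ... | no w∉S = trans (isolated-adjacent iso-c w∉S) (sym (isolated-adjacent iso-d w∉S))

    -- z = Δ q q' x · Δ p p' − Δ p p' x · Δ q q' vanishes on S and at x.
    sign-balance : ∀ {p p' q q' x y} → Duplicated p p' → Duplicated q q' → x ∉ S → y ∉ S →
      sign (adj G q x) * sign (adj G p y) ≡ sign (adj G p x) * sign (adj G q y)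
    sign-balance {p} {p'} {q} {q'} {x} {y} dup-p dup-q x∉S y∉S = begin
      sign (adj G q x) * sign (adj G p y) ≡⟨ sym (cong₂ _*_ (Δ-outside dup-q x∉S) (Δ-outside dup-p y∉S)) ⟩
      α * Δ p p' y                        ≡⟨ x-y≡0⇒x≡y (trans (sym (z-split y)) (vanishes-identically x∉S Z z≈0 y)) ⟩
      β * Δ q q' y                        ≡⟨ cong₂ _*_ (Δ-outside dup-p x∉S) (Δ-outside dup-q y∉S) ⟩
      sign (adj G p x) * sign (adj G q y) ∎
      where
        α = Δ q q' x
        β = Δ p p' x
        z = lincomb (α ∷ - α ∷ - β ∷ β ∷ []) (A G ∘ (p ∷ p' ∷ q ∷ q' ∷ []))
        Z : RowComb (A G) (_∈ S) z
        Z = rowComb (A G) (α ∷ - α ∷ - β ∷ β ∷ []) (p ∷ p' ∷ q ∷ q' ∷ [])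
              λ { zero → left∈S dup-p ; (suc zero) → right∈S dup-p
                ; (suc (suc zero)) → left∈S dup-q ; (suc (suc (suc zero))) → right∈S dup-q }
        z-split : ∀ t → z t ≡ α * Δ p p' t - β * Δ q q' t
        z-split t = solve 6 (λ α β a a' b b' →
                                α :* a :+ ((:- α) :* a' :+ ((:- β) :* b :+ (β :* b' :+ con 0ℚ)))
                             := α :* (con 1ℚ :* a :+ (:- con 1ℚ :* a' :+ con 0ℚ))
                                :- β :* (con 1ℚ :* b :+ (:- con 1ℚ :* b' :+ con 0ℚ)))
                            refl α β (A G p t) (A G p' t) (A G q t) (A G q' t)
        z≈0 : VanishesOn ((_∈ S) ∪ ｛ x ｝) z
        z≈0 t (inj₁ t∈S) = begin
          z t                                   ≡⟨ z-split t ⟩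
          α * Δ p p' t - β * Δ q q' t
            ≡⟨ cong₂ (λ a b → α * a - β * b) (Δ-vanishes dup-p t t∈S) (Δ-vanishes dup-q t t∈S) ⟩
          α * 0ℚ - β * 0ℚ                       ≡⟨ solve 2 (λ α β → α :* con 0ℚ :- β :* con 0ℚ := con 0ℚ) refl α β ⟩
          0ℚ                                    ∎
        z≈0 t (inj₂ refl) = trans (z-split x) (solve 2 (λ α β → α :* β :- β :* α := con 0ℚ) refl α β)

    aligned : ∀ {v v' y} → Duplicated v v' → y ∉ S → adj G v x₀ ≡ adj G u₀ x₀ → adj G v y ≡ adj G u₀ y
    aligned {v} {y = y} dup y∉S vx₀≡u₀x₀ = sym (sign-cancelˡ (adj G u₀ x₀) (begin
      sign (adj G u₀ x₀) * sign (adj G u₀ y) ≡⟨ cong (λ a → sign a * sign (adj G u₀ y)) (sym vx₀≡u₀x₀) ⟩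
      sign (adj G v x₀) * sign (adj G u₀ y)  ≡⟨ sign-balance dup₀ dup x₀∉S y∉S ⟩
      sign (adj G u₀ x₀) * sign (adj G v y)  ∎))

    class-sides : ∀ C → DupClass G S C → ∃[ v ] ∃[ v' ] (v ∈ C × v' ∈ C × v ≢ v' ×
      (∀ w → w ∈ T₁ → Nb G v w × ¬ Nb G v' w) × (∀ w → w ∈ T₂ → Nb G v' w × ¬ Nb G v w))
    class-sides C (dupSet , _) with oriented dupSet
    ... | v , v' , v∈C , v'∈C , dup , v-aligned = v , v' , v∈C , v'∈C , distinct dup , on-T₁ , on-T₂
      where
        on-T₁ : ∀ w → w ∈ T₁ → Nb G v w × ¬ Nb G v' w
        on-T₁ w w∈T₁ = vw , λ v'w → separated dup w∉S (trans vw (sym v'w))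
          where
            w∉S = proj₁ (∈-subsetOf⁻ (on-side? true) w∈T₁)
            vw = trans (aligned dup w∉S v-aligned) (proj₂ (∈-subsetOf⁻ (on-side? true) w∈T₁))
        on-T₂ : ∀ w → w ∈ T₂ → Nb G v' w × ¬ Nb G v w
        on-T₂ w w∈T₂ = trans (¬-not (separated dup w∉S ∘ sym)) (cong not vw) , λ vw′ → true≢false (trans (sym vw′) vw)
          where
            w∉S = proj₁ (∈-subsetOf⁻ (on-side? false) w∈T₂)
            vw = trans (aligned dup w∉S v-aligned) (proj₂ (∈-subsetOf⁻ (on-side? false) w∈T₂))

    split : SplitCond G S T₁ T₂
    split = disjoint , cover , T⇒∉S , class-sides
      where
        disjoint : ∀ w → ¬ (w ∈ T₁ × w ∈ T₂)
        disjoint w (w∈T₁ , w∈T₂) =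
          true≢false (trans (sym (proj₂ (∈-subsetOf⁻ (on-side? true) w∈T₁))) (proj₂ (∈-subsetOf⁻ (on-side? false) w∈T₂)))
        cover : ∀ w → w ∉ S → w ∈ T₁ ⊎ w ∈ T₂
        cover w w∉S with adj G u₀ w in u₀w
        ... | true  = inj₁ (∈-subsetOf⁺ (on-side? true) (w∉S , u₀w))
        ... | false = inj₂ (∈-subsetOf⁺ (on-side? false) (w∉S , u₀w))
        T⇒∉S : ∀ w → w ∈ T₁ ⊎ w ∈ T₂ → w ∉ S
        T⇒∉S w (inj₁ w∈T₁) = proj₁ (∈-subsetOf⁻ (on-side? true) w∈T₁)
        T⇒∉S w (inj₂ w∈T₂) = proj₁ (∈-subsetOf⁻ (on-side? false) w∈T₂)

    -- z = A v − A v' − A c vanishes on S and on T₁, but z b = −2 for b ∈ T₂.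
    split-nonempty⇒no-isolated : ∀ T₁ T₂ → SplitCond G S T₁ T₂ → (∃[ a ] a ∈ T₁) → (∃[ b ] b ∈ T₂) →
      ∀ c → ¬ IsolatedIn G S c
    split-nonempty⇒no-isolated T₁ T₂ (_ , _ , T⇒∉S , classes) (a , a∈T₁) (b , b∈T₂) c iso@(c∈S , isolated)
      with classes class₀ class₀-DupClass
    ... | v , v' , v∈ , v'∈ , v≢v' , on-T₁ , on-T₂ =
      combination-at-T₂ (proj₂ (on-T₂ b b∈T₂)) (proj₁ (on-T₂ b b∈T₂)) (isolated-adjacent iso b∉S)
        (vanishes-identically a∉S Z z≈0 b)
      where
        a∉S = T⇒∉S a (inj₁ a∈T₁)
        b∉S = T⇒∉S b (inj₂ b∈T₂)
        dup = DupSet⇒Duplicated (proj₁ class₀-DupClass) v∈ v'∈ v≢v'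
        z = lincomb (1ℚ ∷ - 1ℚ ∷ - 1ℚ ∷ []) (A G ∘ (v ∷ v' ∷ c ∷ []))
        Z : RowComb (A G) (_∈ S) z
        Z = rowComb (A G) (1ℚ ∷ - 1ℚ ∷ - 1ℚ ∷ []) (v ∷ v' ∷ c ∷ [])
              λ { zero → left∈S dup ; (suc zero) → right∈S dup ; (suc (suc zero)) → c∈S }
        combination-at-T₁ : ∀ {p q r : Bool} → p ≡ true → q ≡ false → r ≡ true →
          1ℚ * (if p then 1ℚ else 0ℚ) + (- 1ℚ * (if q then 1ℚ else 0ℚ) + (- 1ℚ * (if r then 1ℚ else 0ℚ) + 0ℚ)) ≡ 0ℚ
        combination-at-T₁ refl refl refl = refl
        combination-at-T₂ : ∀ {p q r : Bool} → ¬ p ≡ true → q ≡ true → r ≡ true →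
          ¬ 1ℚ * (if p then 1ℚ else 0ℚ) + (- 1ℚ * (if q then 1ℚ else 0ℚ) + (- 1ℚ * (if r then 1ℚ else 0ℚ) + 0ℚ)) ≡ 0ℚ
        combination-at-T₂ {true} ¬p _ _ = ⊥-elim (¬p refl)
        combination-at-T₂ {false} _ refl refl ()
        z≈0 : VanishesOn ((_∈ S) ∪ ｛ a ｝) z
        z≈0 t (inj₁ t∈S) =
          trans (cong₂ (λ p r → 1ℚ * (if p then 1ℚ else 0ℚ) + (- 1ℚ * A G v' t + (- 1ℚ * (if r then 1ℚ else 0ℚ) + 0ℚ)))
                       (sameNbh dup t t∈S) (isolated t t∈S))
                (solve 1 (λ x → con 1ℚ :* x :+ (:- con 1ℚ :* x :+ (:- con 1ℚ :* con 0ℚ :+ con 0ℚ)) := con 0ℚ) refl (A G v' t))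
        z≈0 t (inj₂ refl) = combination-at-T₁ (proj₁ (on-T₁ a a∈T₁)) (¬-not (proj₂ (on-T₁ a a∈T₁))) (isolated-adjacent iso a∉S)

open import Data.Nat using (_+_)

lemma2p3 : ∀ {n} (G : Graph n) (S : Subset n) →
    Reduced G → MaxDup G S →
    (∀ rG rH → RankIs G ⊤ rG → RankIs G S rH → rG ≤ rH + 3) →
    ((∀ c → IsolatedIn G S c → ∀ w → (Nb G c w → w ∉ S) × (w ∉ S → Nb G c w))
    × ((∀ C → DupClass G S C → ∣ C ∣ ≡ 2)
      × (∀ c d → IsolatedIn G S c → IsolatedIn G S d → c ≡ d))
    × (∃[ T₁ ] ∃[ T₂ ] SplitCond G S T₁ T₂)
    × (∀ T₁ T₂ → SplitCond G S T₁ T₂ → (∃[ a ] a ∈ T₁) → (∃[ b ] b ∈ T₂) →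
         ∀ c → ¬ IsolatedIn G S c))
lemma2p3 G S reduced maxDup rank-gap =
    (λ _ → isolated-nbh)
  , (dupClass-size , λ _ _ → isolated-unique)
  , (T₁ , T₂ , split)
  , split-nonempty⇒no-isolated
  where
    open MaximumDuplicated G S reduced maxDup
    open RankGapAtMostThree rank-gap
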